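{- Let $\mathcal G$ be a simple directed graph whose directed flag complex $S$ is given as arrays $S_0,\dots,S_D$ ($S_k$ the list of $k$-simplices, $D$ the maximal simplex dimension), and let $d\in\{2,\dots,D+1\}$. The following procedure $\mathtt{ads\_enumerator}(d,S_{d-1},S_{d-2})$ enumerates all almost-$d$-simplices of $S$, each exactly once and nothing else: first compute, for each $\tau\in S_{d-2}$, the list $\mathrm{coB}(\tau)$ by creating an empty list for each $\tau\in S_{d-2}$ and, for each $\sigma=(v_0,\dots,v_{d-1})\in S_{d-1}$ and each $j\in\{0,\dots,d-1\}$, appending $(\sigma,j,v_j)$ to $\mathrm{coB}(\partial_j\sigma)$; then for each $\check\sigma\in S_{d-2}$ and each pair of indices $0\le k<l<|\mathrm{coB}(\check\sigma)|$, with $(\sigma,i,v)=\mathrm{coB}(\check\sigma)[k]$ and $(\sigma',i',v')=\mathrm{coB}(\check\sigma)[l]$, if $v\neq v'$ then output $(\{\sigma,\sigma'\},(v,v'))$ if $i\le i'$ and output $(\{\sigma,\sigma'\},(v',v))$ if $i\ge i'$. Its running time is $\mathcal O(N_{d-2}+d^2N_{d-1}+N_d^A)$, where $N_k=|S_k|$ and $N_d^A$ is the number of almost-$d$-simplices in $S$.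
   Context: A simple directed graph is a pair $\mathcal G=(V,E)$ with $V$ finite and $E\subseteq (V\times V)\setminus\{(v,v):v\in V\}$. A $k$-simplex of $\mathcal G$ is a tuple $(v_0,\dots,v_k)$ of distinct vertices with $(v_i,v_j)\in E$ for all $i<j$; the directed flag complex is the set of all simplices, $S_k$ the $k$-simplices. $\partial_i(v_0,\dots,v_k)=(v_0,\dots,v_{i-1},v_{i+1},\dots,v_k)$. For $d\ge2$, an almost-$d$-simplex is a tuple $(\{\sigma,\sigma'\},e)$ where $\sigma=(v_0,\dots,v_{d-1})$, $\sigma'=(v'_0,\dots,v'_{d-1})$ are $(d-1)$-simplices and $e$ is an ordered pair of vertices (not necessarily an edge) such that for some $i,i'\in\{0,\dots,d-1\}$: (1) $\partial_i(\sigma)=\partial_{i'}(\sigma')$, (2) $v_i\neq v'_{i'}$, (3) $e=(v_i,v'_{i'})$ (allowed only if $i\le i'$) or $e=(v'_{i'},v_i)$ (allowed only if $i'\le i$). -}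

module Defs where

open import Data.Nat using (ℕ; zero; suc; _+_; _*_; _<_)
open import Data.Fin using (Fin; _≤?_) renaming (_<_ to _<ᶠ_; _≤_ to _≤ᶠ_)
import Data.Fin.Properties as FinP
open import Data.Vec using (Vec; lookup; removeAt)
import Data.Vec.Properties as VecP
open import Data.List using (List; []; _∷_; _++_; map; concatMap; filter; length; allFin)
open import Data.Nat.ListAction using (sum)
import Data.List as L
open import Data.List.Membership.Propositional using (_∈_)
open import Data.List.Relation.Unary.Unique.Propositional using (Unique)
open import Data.Product using (Σ; ∃; _×_; _,_; proj₁; proj₂)
open import Data.Sum using (_⊎_)
open import Relation.Nullary using (¬_; yes; no)
open import Relation.Binary.PropositionalEquality using (_≡_; _≢_)
open import Function.Bundles using (_⇔_)

IsSimple : {n : ℕ} → (Fin n → Fin n → Set) → Set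
IsSimple {n} E = (v : Fin n) → ¬ E v v

IsSimplex : {n : ℕ} → (Fin n → Fin n → Set) → (k : ℕ) → Vec (Fin n) (suc k) → Set
IsSimplex E k σ =
  ((i j : Fin (suc k)) → i ≢ j → lookup σ i ≢ lookup σ j)
  × ((i j : Fin (suc k)) → i <ᶠ j → E (lookup σ i) (lookup σ j))

∂ : {n k : ℕ} → Fin (suc (suc k)) → Vec (Fin n) (suc (suc k)) → Vec (Fin n) (suc k)
∂ i σ = removeAt σ i

IsFlagComplexArrays : {n : ℕ} → (Fin n → Fin n → Set)
  → ((k : ℕ) → List (Vec (Fin n) (suc k))) → Set
IsFlagComplexArrays {n} E S =
  (k : ℕ) → Unique (S k) × ((σ : Vec (Fin n) (suc k)) → (σ ∈ S k) ⇔ IsSimplex E k σ)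

IsMaxDim : {n : ℕ} → (Fin n → Fin n → Set) → ℕ → Set
IsMaxDim {n} E D =
  (Σ (Vec (Fin n) (suc D)) λ σ → IsSimplex E D σ)
  × ((k : ℕ) → D < k → (σ : Vec (Fin n) (suc k)) → ¬ IsSimplex E k σ)

-- Almost-d-simplices, for d = suc (suc m) (i.e. d ≥ 2).
-- A candidate ({σ,σ'},e) is represented by an ordered triple (σ , σ' , e);
-- the unordered pair {σ,σ'} is recovered through the equivalence _≈ᴬ_.

Cand : ℕ → ℕ → Set
Cand n m = Vec (Fin n) (suc (suc m)) × Vec (Fin n) (suc (suc m)) × (Fin n × Fin n)

_≈ᴬ_ : {n m : ℕ} → Cand n m → Cand n m → Set
(σ , σ' , e) ≈ᴬ (τ , τ' , f) =
  ((σ ≡ τ × σ' ≡ τ') ⊎ (σ ≡ τ' × σ' ≡ τ)) × e ≡ f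

IsAlmostSimplex : {n : ℕ} → (Fin n → Fin n → Set) → (m : ℕ) → Cand n m → Set
IsAlmostSimplex E m (σ , σ' , e) =
  IsSimplex E (suc m) σ × IsSimplex E (suc m) σ' ×
  (Σ (Fin (suc (suc m))) λ i → Σ (Fin (suc (suc m))) λ i' →
      ∂ i σ ≡ ∂ i' σ'
    × lookup σ i ≢ lookup σ' i'
    × ((e ≡ (lookup σ i , lookup σ' i') × i ≤ᶠ i')
       ⊎ (e ≡ (lookup σ' i' , lookup σ i) × i' ≤ᶠ i)))

EnumeratesExactlyOnce : {n : ℕ} → (Fin n → Fin n → Set) → (m : ℕ) → List (Cand n m) → Set
EnumeratesExactlyOnce {n} E m L =
  ((k : Fin (length L)) → IsAlmostSimplex E m (L.lookup L k))
  × ((a : Cand n m) → IsAlmostSimplex E m a →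
       Σ (Fin (length L)) (λ k → L.lookup L k ≈ᴬ a)
     × ((k k' : Fin (length L)) → L.lookup L k ≈ᴬ a → L.lookup L k' ≈ᴬ a → k ≡ k'))

Entry : ℕ → ℕ → Set
Entry n m = Vec (Fin n) (suc (suc m)) × Fin (suc (suc m)) × Fin n

-- For each σ ∈ Sd1 (in order) and each j = 0,…,d-1 (in order):
-- the record "append (σ , j , v_j) to coB(∂_j σ)".
appends : {n m : ℕ} → List (Vec (Fin n) (suc (suc m)))
  → List (Vec (Fin n) (suc m) × Entry n m)
appends {n} {m} Sd1 =
  concatMap (λ σ → map (λ j → (∂ j σ , (σ , j , lookup σ j))) (allFin (suc (suc m)))) Sd1

-- coB(τ): the list built for τ by the appends, in order of appending.
coB : {n m : ℕ} → List (Vec (Fin n) (suc (suc m))) → Vec (Fin n) (suc m) → List (Entry n m)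
coB {n} Sd1 τ =
  map proj₂ (filter (λ p → VecP.≡-dec FinP._≟_ (proj₁ p) τ) (appends Sd1))

pairs : {A : Set} → List A → List (A × A)
pairs []       = []
pairs (x ∷ xs) = map (x ,_) xs ++ pairs xs

emit : {n m : ℕ} → Entry n m × Entry n m → List (Cand n m)
emit ((σ , i , v) , (σ' , i' , v')) with FinP._≟_ v v'
... | yes _ = []
... | no  _ = first ++ second
  where
  first : List _
  first with i ≤? i'
  ... | yes _ = (σ , σ' , (v , v')) ∷ []
  ... | no  _ = []
  second : List _
  second with i' ≤? i
  ... | yes _ = (σ , σ' , (v' , v)) ∷ []
  ... | no  _ = []

ads-enumerator : {n : ℕ} (m : ℕ) → List (Vec (Fin n) (suc (suc m)))
  → List (Vec (Fin n) (suc m)) → List (Cand n m)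
ads-enumerator m Sd1 Sd2 = concatMap (λ τ → concatMap emit (pairs (coB Sd1 τ))) Sd2

-- Cost model (unit-cost RAM, coB stored in a dictionary keyed by τ):
--  * creating an empty list for each τ ∈ S_{d-2}: 1 step each;
--  * for each σ ∈ S_{d-1} and each j < d: computing ∂_j σ (a tuple of
--    d-1 vertices), locating coB(∂_j σ) and appending: d steps;
--  * for each τ ∈ S_{d-2}: 1 step of loop overhead, plus 1 step for each
--    pair k < l (comparing v , v' and i , i' and emitting ≤ 2 outputs).
ads-cost : {n : ℕ} (m : ℕ) → List (Vec (Fin n) (suc (suc m)))
  → List (Vec (Fin n) (suc m)) → ℕ
ads-cost m Sd1 Sd2 =
    sum (map (λ τ → 1) Sd2)
  + sum (map (λ σ → sum (map (λ j → suc (suc m)) (allFin (suc (suc m))))) Sd1)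
  + sum (map (λ τ → 1 + length (pairs (coB Sd1 τ))) Sd2)

-- An almost-d-simplex ({σ,σ'},e) determines its common face τ = ∂ᵢσ = ∂ᵢ'σ' (the vertices shared
-- by σ and σ'), and σ, σ' occur in coB(τ) as the entries (σ,i,σᵢ), (σ',i',σ'ᵢ').  Hence it is produced
-- from exactly one pair of entries of exactly one list coB(τ), the orientation test singling out e.
-- For the cost, a pair of entries with different vertices is paid for by an output, while two entries
-- of coB(τ) with the same vertex v and index j are both insertAt τ j v, so an entry shares its vertex
-- with at most d others; and the lists coB(τ) have total length d·N_{d-1}.
module Submission where

open import Defs
open import Data.Nat using (ℕ; suc; _+_; _*_; _≤_; z≤n; s≤s)
import Data.Nat.Properties as ℕ
open import Algebra.Properties.CommutativeSemigroup ℕ.+-commutativeSemigroup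
  using () renaming (interchange to +-interchange)
open import Data.Nat.ListAction using (sum)
open import Data.Nat.Tactic.RingSolver using (solve-∀)
open import Data.Fin using (Fin; zero; suc; punchIn; punchOut; _≤?_; _≟_)
  renaming (_<_ to _<ᶠ_; _≤_ to _≤ᶠ_)
import Data.Fin.Properties as Fin
open import Data.Vec using (Vec; lookup; removeAt; insertAt)
import Data.Vec.Properties as Vec
open import Data.List using (List; []; _∷_; _++_; map; concatMap; filter; length; allFin)
import Data.List as List
import Data.List.Properties as List
open import Data.List.Membership.Propositional using (_∈_; find; lose)
open import Data.List.Membership.Propositional.Properties
  using (∈-++⁻; ∈-++⁺ˡ; ∈-++⁺ʳ; ∈-map⁻; ∈-map⁺; ∈-filter⁻; ∈-filter⁺; ∈-allFin;
         ∈-concatMap⁻; ∈-concatMap⁺; ∈-lookup)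
open import Data.List.Relation.Unary.Any using (Any; here; there)
import Data.List.Relation.Unary.Any as Any
import Data.List.Relation.Unary.Any.Properties as Any
open import Data.List.Relation.Unary.All using (All; []; _∷_)
import Data.List.Relation.Unary.All as All
import Data.List.Relation.Unary.All.Properties as All
open import Data.List.Relation.Unary.AllPairs using (AllPairs; []; _∷_)
import Data.List.Relation.Unary.AllPairs as AllPairs
import Data.List.Relation.Unary.AllPairs.Properties as AllPairs
open import Data.List.Relation.Unary.Unique.Propositional using (Unique)
open import Data.Product using (Σ; ∃; _×_; _,_; proj₁; proj₂)
import Data.Product as Product
open import Data.Sum using (_⊎_; inj₁; inj₂; [_,_])
import Data.Sum as Sum
open import Data.Empty using (⊥-elim)
open import Function using (_∘_; _on_; id)
open import Function.Bundles using (Equivalence)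
open import Relation.Nullary using (¬_; yes; no; contradiction)
open import Relation.Unary using (Decidable)
open import Relation.Binary using (Symmetric; Transitive; DecidableEquality)
open import Relation.Binary.PropositionalEquality hiding ([_])

Distinct : {A : Set} {k : ℕ} → Vec A k → Set
Distinct {k = k} σ = (i j : Fin k) → i ≢ j → lookup σ i ≢ lookup σ j

module _ {A : Set} where

  lookup-removeAt : {k : ℕ} (σ : Vec A (suc k)) (i : Fin (suc k)) (j : Fin k) →
                    lookup (removeAt σ i) j ≡ lookup σ (punchIn i j)
  lookup-removeAt σ i j =
    trans (sym (Vec.insertAt-punchIn (removeAt σ i) i (lookup σ i) j))
          (cong (λ ρ → lookup ρ (punchIn i j)) (Vec.insertAt-removeAt σ i))

  lookup∉removeAt : {k : ℕ} (σ : Vec A (suc k)) → Distinct σ → (i : Fin (suc k)) (j : Fin k) →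
                    lookup σ i ≢ lookup (removeAt σ i) j
  lookup∉removeAt σ σ-distinct i j eq =
    σ-distinct i (punchIn i j) (Fin.punchInᵢ≢i i j ∘ sym) (trans eq (lookup-removeAt σ i j))

  lookup∈removeAt : {k : ℕ} (σ : Vec A (suc k)) {i j : Fin (suc k)} (i≢j : i ≢ j) →
                    lookup σ j ≡ lookup (removeAt σ i) (punchOut i≢j)
  lookup∈removeAt σ i≢j = sym (Vec.removeAt-punchOut σ i≢j)

  removeAt-injective : {k : ℕ} (σ : Vec A (suc (suc k))) → Distinct σ → (i j : Fin (suc (suc k))) →
                       removeAt σ i ≡ removeAt σ j → i ≡ j
  removeAt-injective σ σ-distinct i j eq with i ≟ j
  ... | yes i≡j = i≡j
  ... | no i≢j = contradiction
    (trans (lookup∈removeAt σ (i≢j ∘ sym)) (cong (λ ρ → lookup ρ _) (sym eq)))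
    (lookup∉removeAt σ σ-distinct i _)

  insertAt-removeAt′ : {k : ℕ} (σ : Vec A (suc k)) (i : Fin (suc k)) {τ : Vec A k} {v : A} →
                       removeAt σ i ≡ τ → lookup σ i ≡ v → insertAt τ i v ≡ σ
  insertAt-removeAt′ σ i refl refl = Vec.insertAt-removeAt σ i

  -- σᵢ is not a vertex of σ' (it is neither σ'ᵢ' nor in ∂ᵢσ = ∂ᵢ'σ'), yet for j ≠ i it is a
  -- vertex of ∂ⱼσ = ∂ⱼ'σ'.
  common-face-unique : {k : ℕ} (σ σ' : Vec A (suc (suc k))) → Distinct σ →
                       {i i' j j' : Fin (suc (suc k))} →
                       removeAt σ i ≡ removeAt σ' i' → lookup σ i ≢ lookup σ' i' →
                       removeAt σ j ≡ removeAt σ' j' → i ≡ j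
  common-face-unique {k} σ σ' σ-distinct {i} {i'} {j} {j'} ∂ᵢ≡ σᵢ≢σ'ᵢ' ∂ⱼ≡ with i ≟ j
  ... | yes i≡j = i≡j
  ... | no i≢j = ⊥-elim (σᵢ∉σ' _ σᵢ∈σ')
    where
    σᵢ∈σ' : lookup σ i ≡ lookup σ' (punchIn j' (punchOut (i≢j ∘ sym)))
    σᵢ∈σ' = trans (lookup∈removeAt σ (i≢j ∘ sym))
              (trans (cong (λ ρ → lookup ρ _) ∂ⱼ≡) (lookup-removeAt σ' j' _))
    σᵢ∉σ' : (r : Fin (suc (suc k))) → lookup σ i ≢ lookup σ' r
    σᵢ∉σ' r eq with r ≟ i'
    ... | yes refl = σᵢ≢σ'ᵢ' eq
    ... | no r≢i' = lookup∉removeAt σ σ-distinct i _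
      (trans eq (trans (lookup∈removeAt σ' (r≢i' ∘ sym)) (cong (λ ρ → lookup ρ _) (sym ∂ᵢ≡))))

∂-IsSimplex : {n : ℕ} (E : Fin n → Fin n → Set) (k : ℕ) {σ : Vec (Fin n) (suc (suc k))} →
              IsSimplex E (suc k) σ → (i : Fin (suc (suc k))) → IsSimplex E k (∂ i σ)
∂-IsSimplex E k {σ} (σ-distinct , σ-edges) i = distinct , edges
  where
  distinct : Distinct (∂ i σ)
  distinct a b a≢b eq = σ-distinct (punchIn i a) (punchIn i b) (a≢b ∘ Fin.punchIn-injective i a b)
    (trans (sym (lookup-removeAt σ i a)) (trans eq (lookup-removeAt σ i b)))
  edges : (a b : Fin (suc k)) → a <ᶠ b → E (lookup (∂ i σ) a) (lookup (∂ i σ) b)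
  edges a b a<b rewrite lookup-removeAt σ i a | lookup-removeAt σ i b =
    σ-edges _ _ (Fin.≤∧≢⇒< (Fin.punchIn-mono-≤ i a b (ℕ.<⇒≤ a<b))
                           (Fin.<⇒≢ a<b ∘ Fin.punchIn-injective i a b))

module _ {A : Set} where

  sum-map-+ : (f g : A → ℕ) (xs : List A) →
              sum (map (λ x → f x + g x) xs) ≡ sum (map f xs) + sum (map g xs)
  sum-map-+ f g [] = refl
  sum-map-+ f g (x ∷ xs) rewrite sum-map-+ f g xs = +-interchange (f x) (g x) _ _

  sum-map-* : (c : ℕ) (f : A → ℕ) (xs : List A) → sum (map (λ x → c * f x) xs) ≡ c * sum (map f xs)
  sum-map-* c f [] = sym (ℕ.*-zeroʳ c)
  sum-map-* c f (x ∷ xs) rewrite sum-map-* c f xs = sym (ℕ.*-distribˡ-+ c (f x) _)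

  sum-map-const : (c : ℕ) (xs : List A) → sum (map (λ _ → c) xs) ≡ length xs * c
  sum-map-const c [] = refl
  sum-map-const c (x ∷ xs) = cong (c +_) (sum-map-const c xs)

  sum-map-mono-≤ : {f g : A → ℕ} (xs : List A) → (∀ x → f x ≤ g x) → sum (map f xs) ≤ sum (map g xs)
  sum-map-mono-≤ [] f≤g = z≤n
  sum-map-mono-≤ (x ∷ xs) f≤g = ℕ.+-mono-≤ (f≤g x) (sum-map-mono-≤ xs f≤g)

  length-concatMap : {B : Set} (f : A → List B) (xs : List A) →
                     length (concatMap f xs) ≡ sum (map (length ∘ f) xs)
  length-concatMap f [] = refl
  length-concatMap f (x ∷ xs) = trans (List.length-++ (f x)) (cong (length (f x) +_) (length-concatMap f xs))

  ∈⇒1≤length : {x : A} {xs : List A} → x ∈ xs → 1 ≤ length xs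
  ∈⇒1≤length (here _) = s≤s z≤n
  ∈⇒1≤length (there _) = s≤s z≤n

  length-filter-∷ : {P : A → Set} (P? : Decidable P) (x : A) (xs : List A) →
                    length (filter P? xs) ≤ length (filter P? (x ∷ xs))
  length-filter-∷ P? x xs with P? x
  ... | yes _ = ℕ.n≤1+n _
  ... | no _ = ℕ.≤-refl

  AllPairs-restrict : {P : A → Set} {R : A → A → Set} {xs : List A} →
                      All P xs → AllPairs (λ x y → P x → P y → R x y) xs → AllPairs R xs
  AllPairs-restrict [] [] = []
  AllPairs-restrict (px ∷ pxs) (rs ∷ rss) =
    All.zipWith (λ (py , r) → r px py) (pxs , rs) ∷ AllPairs-restrict pxs rss

  AllPairs-concatMap⁺ : {B : Set} {R : B → B → Set} (f : A → List B) {xs : List A} →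
                        (∀ {x} → x ∈ xs → AllPairs R (f x)) →
                        AllPairs (λ x y → ∀ {a b} → a ∈ f x → b ∈ f y → R a b) xs →
                        AllPairs R (concatMap f xs)
  AllPairs-concatMap⁺ f within across = AllPairs.concat⁺ (All.map⁺ (All.tabulate within))
    (AllPairs.map⁺ (AllPairs.map (λ r → All.tabulate λ a∈ → All.tabulate λ b∈ → r a∈ b∈) across))

  module _ {_≈_ : A → A → Set} (≈-sym : Symmetric _≈_) (≈-trans : Transitive _≈_) where

    AllPairs-lookup-unique : {xs : List A} → AllPairs (λ x y → ¬ x ≈ y) xs →
                             {a : A} (k k' : Fin (length xs)) →
                             List.lookup xs k ≈ a → List.lookup xs k' ≈ a → k ≡ k'
    AllPairs-lookup-unique (_ ∷ _) zero zero _ _ = refl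
    AllPairs-lookup-unique (x≉ ∷ _) zero (suc k') x≈a y≈a =
      contradiction (≈-trans x≈a (≈-sym y≈a)) (All.lookup x≉ (∈-lookup k'))
    AllPairs-lookup-unique (x≉ ∷ _) (suc k) zero y≈a x≈a =
      contradiction (≈-trans x≈a (≈-sym y≈a)) (All.lookup x≉ (∈-lookup k))
    AllPairs-lookup-unique (_ ∷ apart) (suc k) (suc k') y≈a y'≈a =
      cong suc (AllPairs-lookup-unique apart k k' y≈a y'≈a)

    length-≤-of-cover : {xs : List A} → AllPairs (λ x y → ¬ x ≈ y) xs → (ys : List A) →
                        ((k : Fin (length xs)) →
                          Σ (Fin (length ys)) λ j → List.lookup ys j ≈ List.lookup xs k) →
                        length xs ≤ length ys
    length-≤-of-cover apart ys cover = Fin.injective⇒≤ {f = proj₁ ∘ cover} injective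
      where
      injective : ∀ {k k'} → proj₁ (cover k) ≡ proj₁ (cover k') → k ≡ k'
      injective {k} {k'} eq = AllPairs-lookup-unique apart k k'
        (≈-sym (proj₂ (cover k)))
        (≈-sym (subst (λ j → List.lookup ys j ≈ _) (sym eq) (proj₂ (cover k'))))

  length-≤-of-injective : {d : ℕ} (f : A → Fin d) {xs : List A} →
                          AllPairs (λ x y → f x ≢ f y) xs → length xs ≤ d
  length-≤-of-injective f {xs} apart = Fin.injective⇒≤ {f = f ∘ List.lookup xs}
    (λ {k} {k'} eq → AllPairs-lookup-unique {_≈_ = _≡_ on f} sym trans apart k k' eq refl)

  pairs-⊆ : (xs : List A) {p q : A} → (p , q) ∈ pairs xs → p ∈ xs × q ∈ xs
  pairs-⊆ (x ∷ xs) pq∈ with ∈-++⁻ (map (x ,_) xs) pq∈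
  ... | inj₁ pq∈head with ∈-map⁻ (x ,_) pq∈head
  ...   | y , y∈ , refl = here refl , there y∈
  pairs-⊆ (x ∷ xs) pq∈ | inj₂ pq∈tail = Product.map there there (pairs-⊆ xs pq∈tail)

  ∈-pairs : (xs : List A) {p q : A} → p ∈ xs → q ∈ xs → p ≢ q →
            (p , q) ∈ pairs xs ⊎ (q , p) ∈ pairs xs
  ∈-pairs (x ∷ xs) (here refl) (here refl) p≢q = contradiction refl p≢q
  ∈-pairs (x ∷ xs) (here refl) (there q∈) _ = inj₁ (∈-++⁺ˡ (∈-map⁺ (x ,_) q∈))
  ∈-pairs (x ∷ xs) (there p∈) (here refl) _ = inj₂ (∈-++⁺ˡ (∈-map⁺ (x ,_) p∈))
  ∈-pairs (x ∷ xs) (there p∈) (there q∈) p≢q =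
    Sum.map (∈-++⁺ʳ (map (x ,_) xs)) (∈-++⁺ʳ (map (x ,_) xs)) (∈-pairs xs p∈ q∈ p≢q)

_≐_ : {A : Set} → A × A → A × A → Set
(p , q) ≐ (p' , q') = (p ≡ p' × q ≡ q') ⊎ (p ≡ q' × q ≡ p')

module _ {A B : Set} (f : A → B) where

  pairs-apart : {xs : List A} → AllPairs (λ x y → f x ≢ f y) xs →
                AllPairs (λ u w → ¬ Product.map f f u ≐ Product.map f f w) (pairs xs)
  pairs-apart {[]} [] = []
  pairs-apart {x ∷ xs} (x-apart ∷ apart) = AllPairs.++⁺ first-apart (pairs-apart apart) first-rest-apart
    where
    first-apart : AllPairs (λ u w → ¬ Product.map f f u ≐ Product.map f f w) (map (x ,_) xs)
    first-apart = AllPairs.map⁺ (AllPairs-restrict x-apart (AllPairs.map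
      (λ fy≢fy' _ fx≢fy' → [ fy≢fy' ∘ proj₂ , fx≢fy' ∘ proj₁ ]) apart))
    first-rest-apart : All (λ u → All (λ w → ¬ Product.map f f u ≐ Product.map f f w) (pairs xs))
                           (map (x ,_) xs)
    first-rest-apart = All.tabulate λ u∈ → All.tabulate λ w∈ → case u∈ w∈
      where
      case : ∀ {u w} → u ∈ map (x ,_) xs → w ∈ pairs xs → ¬ Product.map f f u ≐ Product.map f f w
      case u∈ w∈ with ∈-map⁻ (x ,_) u∈ | pairs-⊆ xs w∈
      ... | _ , _ , refl | p∈ , q∈ = [ All.lookup x-apart p∈ ∘ proj₁ , All.lookup x-apart q∈ ∘ proj₁ ]

module _ {A B : Set} {R : A → A → Set} (R? : ∀ x → Decidable (R x))
         (f : A × A → List B) (f-nonempty : ∀ {x y} → ¬ R x y → 1 ≤ length (f (x , y))) where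

  length-≤-outputs+related : (x : A) (ys : List A) →
    length ys ≤ length (concatMap f (map (x ,_) ys)) + length (filter (R? x) ys)
  length-≤-outputs+related x [] = z≤n
  length-≤-outputs+related x (y ∷ ys) = begin
      1 + length ys
    ≤⟨ ℕ.+-mono-≤ one (length-≤-outputs+related x ys) ⟩
      (length (f (x , y)) + length (filter (R? x) (y ∷ []))) +
      (length (concatMap f (map (x ,_) ys)) + length (filter (R? x) ys))
    ≡⟨ +-interchange (length (f (x , y))) (length (filter (R? x) (y ∷ []))) _ _ ⟩
      (length (f (x , y)) + length (concatMap f (map (x ,_) ys))) +
      (length (filter (R? x) (y ∷ [])) + length (filter (R? x) ys))
    ≡⟨ sym (cong₂ _+_ (List.length-++ (f (x , y)))
           (trans (cong length (List.filter-++ (R? x) (y ∷ []) ys))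
                  (List.length-++ (filter (R? x) (y ∷ []))))) ⟩
      length (concatMap f (map (x ,_) (y ∷ ys))) + length (filter (R? x) (y ∷ ys))
    ∎
    where
    open ℕ.≤-Reasoning
    one : 1 ≤ length (f (x , y)) + length (filter (R? x) (y ∷ []))
    one with R? x y
    ... | yes _ = ℕ.m≤n+m 1 _
    ... | no ¬r = ℕ.≤-trans (f-nonempty ¬r) (ℕ.m≤m+n _ 0)

  -- A pair is either paid for by an output of f, or is one of at most d related ones per first entry.
  length-pairs-≤ : (d : ℕ) (xs : List A) → (∀ x → length (filter (R? x) xs) ≤ d) →
                   length (pairs xs) ≤ length (concatMap f (pairs xs)) + d * length xs
  length-pairs-≤ d [] _ = z≤n
  length-pairs-≤ d (x ∷ xs) related≤d = begin
      length (map (x ,_) xs ++ pairs xs)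
    ≡⟨ trans (List.length-++ (map (x ,_) xs)) (cong (_+ length (pairs xs)) (List.length-map (x ,_) xs)) ⟩
      length xs + length (pairs xs)
    ≤⟨ ℕ.+-mono-≤ (ℕ.≤-trans (length-≤-outputs+related x xs)
                             (ℕ.+-monoʳ-≤ (length F)
                               (ℕ.≤-trans (length-filter-∷ (R? x) x xs) (related≤d x))))
                  (length-pairs-≤ d xs (λ y → ℕ.≤-trans (length-filter-∷ (R? y) x xs) (related≤d y))) ⟩
      (length F + d) + (length G + d * length xs)
    ≡⟨ regroup (length F) (length G) d (length xs) ⟩
      (length F + length G) + d * suc (length xs)
    ≡⟨ cong (_+ d * suc (length xs))
            (sym (trans (cong length (List.concatMap-++ f (map (x ,_) xs) (pairs xs))) (List.length-++ F))) ⟩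
      length (concatMap f (map (x ,_) xs ++ pairs xs)) + d * suc (length xs)
    ∎
    where
    open ℕ.≤-Reasoning
    F = concatMap f (map (x ,_) xs)
    G = concatMap f (pairs xs)
    regroup : (a b e k : ℕ) → (a + e) + (b + e * k) ≡ (a + b) + e * suc k
    regroup = solve-∀

module _ {A K : Set} (_≟ᴷ_ : DecidableEquality K) (key : A → K) where

  private
    bucket : K → List A → List A
    bucket k = filter (λ a → key a ≟ᴷ k)

    count-key : A → List K → ℕ
    count-key a = sum ∘ map (λ k → length (bucket k (a ∷ [])))

    count-key-absent : (a : A) {ks : List K} → All (key a ≢_) ks → count-key a ks ≡ 0
    count-key-absent a [] = refl
    count-key-absent a {k ∷ _} (a≢k ∷ a≢ks) with key a ≟ᴷ k
    ... | yes a≡k = contradiction a≡k a≢k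
    ... | no _ = count-key-absent a a≢ks

    count-key-≤1 : (a : A) {ks : List K} → Unique ks → count-key a ks ≤ 1
    count-key-≤1 a [] = z≤n
    count-key-≤1 a {k ∷ _} (k∉ks ∷ unique) with key a ≟ᴷ k
    ... | yes refl = ℕ.≤-reflexive (cong suc (count-key-absent a k∉ks))
    ... | no _ = count-key-≤1 a unique

  sum-length-bucket-≤ : (as : List A) {ks : List K} → Unique ks →
                        sum (map (λ k → length (bucket k as)) ks) ≤ length as
  sum-length-bucket-≤ [] {ks} _ = ℕ.≤-reflexive (trans (sum-map-const 0 ks) (ℕ.*-zeroʳ (length ks)))
  sum-length-bucket-≤ (a ∷ as) {ks} unique = begin
      sum (map (λ k → length (bucket k (a ∷ as))) ks)
    ≡⟨ cong sum (List.map-cong (λ k →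
         trans (cong length (List.filter-++ (λ b → key b ≟ᴷ k) (a ∷ []) as))
               (List.length-++ (bucket k (a ∷ [])))) ks) ⟩
      sum (map (λ k → length (bucket k (a ∷ [])) + length (bucket k as)) ks)
    ≡⟨ sum-map-+ _ _ ks ⟩
      count-key a ks + sum (map (λ k → length (bucket k as)) ks)
    ≤⟨ ℕ.+-mono-≤ (count-key-≤1 a unique) (sum-length-bucket-≤ as unique) ⟩
      1 + length as
    ∎
    where open ℕ.≤-Reasoning

AllowedEdge : {A : Set} {k : ℕ} → Fin k → Fin k → A → A → A × A → Set
AllowedEdge i i' v v' e = (e ≡ (v , v') × i ≤ᶠ i') ⊎ (e ≡ (v' , v) × i' ≤ᶠ i)

module _ {n m : ℕ} where

  private
    Cell = Vec (Fin n) (suc (suc m))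
    Face = Vec (Fin n) (suc m)

  ≈ᴬ-sym : Symmetric (_≈ᴬ_ {n} {m})
  ≈ᴬ-sym {σ , σ' , e} (inj₁ (refl , refl) , refl) = inj₁ (refl , refl) , refl
  ≈ᴬ-sym {σ , σ' , e} (inj₂ (refl , refl) , refl) = inj₂ (refl , refl) , refl

  ≈ᴬ-trans : Transitive (_≈ᴬ_ {n} {m})
  ≈ᴬ-trans (inj₁ (refl , refl) , refl) w≈y = w≈y
  ≈ᴬ-trans (inj₂ (refl , refl) , refl) (inj₁ (refl , refl) , refl) = inj₂ (refl , refl) , refl
  ≈ᴬ-trans (inj₂ (refl , refl) , refl) (inj₂ (refl , refl) , refl) = inj₁ (refl , refl) , refl

  emit-sound : (p q : Entry n m) {z : Cand n m} → z ∈ emit (p , q) →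
               let (σ , i , v) = p ; (σ' , i' , v') = q in
               v ≢ v' × ∃ λ e → z ≡ (σ , σ' , e) × AllowedEdge i i' v v' e
  emit-sound (σ , i , v) (σ' , i' , v') z∈ with v ≟ v'
  emit-sound _ _ () | yes _
  ... | no v≢v' with i ≤? i' | i' ≤? i
  emit-sound _ _ (here refl) | no v≢v' | yes i≤i' | _ = v≢v' , _ , refl , inj₁ (refl , i≤i')
  emit-sound _ _ (there (here refl)) | no v≢v' | yes _ | yes i'≤i = v≢v' , _ , refl , inj₂ (refl , i'≤i)
  emit-sound _ _ (here refl) | no v≢v' | no _ | yes i'≤i = v≢v' , _ , refl , inj₂ (refl , i'≤i)
  emit-sound _ _ () | no _ | no _ | no _

  emit-complete : {σ σ' : Cell} {i i' : Fin (suc (suc m))} {v v' : Fin n} {e : Fin n × Fin n} →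
                  v ≢ v' → AllowedEdge i i' v v' e → (σ , σ' , e) ∈ emit ((σ , i , v) , (σ' , i' , v'))
  emit-complete {i = i} {i'} {v} {v'} v≢v' allowed with v ≟ v'
  ... | yes v≡v' = contradiction v≡v' v≢v'
  ... | no _ with i ≤? i' | i' ≤? i | allowed
  ... | yes _ | _ | inj₁ (refl , _) = here refl
  ... | no i≰i' | _ | inj₁ (_ , i≤i') = contradiction i≤i' i≰i'
  ... | _ | no i'≰i | inj₂ (_ , i'≤i) = contradiction i'≤i i'≰i
  ... | yes _ | yes _ | inj₂ (refl , _) = there (here refl)
  ... | no _ | yes _ | inj₂ (refl , _) = here refl

  emit-nonempty : {σ σ' : Cell} {i i' : Fin (suc (suc m))} {v v' : Fin n} →
                  v ≢ v' → 1 ≤ length (emit ((σ , i , v) , (σ' , i' , v')))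
  emit-nonempty {i = i} {i'} v≢v' with Fin.≤-total i i'
  ... | inj₁ i≤i' = ∈⇒1≤length (emit-complete v≢v' (inj₁ (refl , i≤i')))
  ... | inj₂ i'≤i = ∈⇒1≤length (emit-complete v≢v' (inj₂ (refl , i'≤i)))

  emit-apart : (p q : Entry n m) → AllPairs (λ z w → ¬ z ≈ᴬ w) (emit (p , q))
  emit-apart (σ , i , v) (σ' , i' , v') with v ≟ v'
  ... | yes _ = []
  ... | no v≢v' with i ≤? i' | i' ≤? i
  ... | yes _ | yes _ = ((v≢v' ∘ cong proj₁ ∘ proj₂) ∷ []) ∷ [] ∷ []
  ... | yes _ | no _ = [] ∷ []
  ... | no _ | yes _ = [] ∷ []
  ... | no _ | no _ = []

  private
    at : (τ : Face) → Decidable (λ (p : Face × Entry n m) → proj₁ p ≡ τ)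
    at τ p = Vec.≡-dec _≟_ (proj₁ p) τ

  InCoB : List Cell → Face → Entry n m → Set
  InCoB xs τ (σ , j , v) = σ ∈ xs × ∂ j σ ≡ τ × lookup σ j ≡ v

  appends-⊆ : (xs : List Cell) {a : Face × Entry n m} → a ∈ appends xs →
              ∃ λ σ → ∃ λ j → σ ∈ xs × a ≡ (∂ j σ , σ , j , lookup σ j)
  appends-⊆ xs a∈ with find (∈-concatMap⁻ _ {xs = xs} a∈)
  ... | σ , σ∈ , a∈σ with ∈-map⁻ _ a∈σ
  ...   | j , _ , refl = σ , j , σ∈ , refl

  ∈-coB⁻ : (xs : List Cell) (τ : Face) {x : Entry n m} → x ∈ coB xs τ → InCoB xs τ x
  ∈-coB⁻ xs τ x∈ with ∈-map⁻ proj₂ x∈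
  ... | a , a∈ , refl with ∈-filter⁻ (at τ) {xs = appends xs} a∈
  ...   | a∈appends , a-at-τ with appends-⊆ xs a∈appends
  ...     | σ , j , σ∈ , refl = σ∈ , a-at-τ , refl

  ∈-coB⁺ : (xs : List Cell) (τ : Face) {x : Entry n m} → InCoB xs τ x → x ∈ coB xs τ
  ∈-coB⁺ xs τ {σ , j , _} (σ∈ , ∂ⱼσ≡τ , refl) =
    ∈-map⁺ proj₂ (∈-filter⁺ (at τ) {xs = appends xs}
      (∈-concatMap⁺ _ (lose σ∈ (∈-map⁺ _ (∈-allFin j)))) ∂ⱼσ≡τ)

  length-appends : (xs : List Cell) → length (appends xs) ≡ length xs * suc (suc m)
  length-appends xs = begin
      length (appends xs)
    ≡⟨ length-concatMap _ xs ⟩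
      sum (map (λ σ → length (map (λ j → (∂ j σ , σ , j , lookup σ j)) (allFin d))) xs)
    ≡⟨ cong sum (List.map-cong (λ σ → trans (List.length-map _ (allFin d)) (List.length-tabulate {n = d} id))
                               xs) ⟩
      sum (map (λ _ → d) xs)
    ≡⟨ sum-map-const _ xs ⟩
      length xs * d
    ∎
    where
    open ≡-Reasoning
    d = suc (suc m)

  sum-length-coB-≤ : (xs : List Cell) {ts : List Face} → Unique ts →
                     sum (map (λ τ → length (coB xs τ)) ts) ≤ length xs * suc (suc m)
  sum-length-coB-≤ xs {ts} unique = begin
      sum (map (λ τ → length (coB xs τ)) ts)
    ≡⟨ cong sum (List.map-cong (λ τ → List.length-map proj₂ (filter (at τ) (appends xs))) ts) ⟩
      sum (map (λ τ → length (filter (at τ) (appends xs))) ts)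
    ≤⟨ sum-length-bucket-≤ (Vec.≡-dec _≟_) proj₁ (appends xs) unique ⟩
      length (appends xs)
    ≡⟨ length-appends xs ⟩
      length xs * suc (suc m)
    ∎
    where open ℕ.≤-Reasoning

  block : List Cell → Face → List (Cand n m)
  block xs τ = concatMap emit (pairs (coB xs τ))

  -- IsAlmostSimplex without the simplex conditions, with the common face ∂ᵢσ = ∂ᵢ'σ' named τ.
  GluedAlong : Face → Cand n m → Set
  GluedAlong τ (σ , σ' , e) = Σ (Fin (suc (suc m))) λ i → Σ (Fin (suc (suc m))) λ i' →
    ∂ i σ ≡ τ × ∂ i' σ' ≡ τ × lookup σ i ≢ lookup σ' i' ×
    AllowedEdge i i' (lookup σ i) (lookup σ' i') e

  GluedAlong-resp-≈ᴬ : {τ : Face} {z w : Cand n m} → z ≈ᴬ w → GluedAlong τ w → GluedAlong τ z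
  GluedAlong-resp-≈ᴬ (inj₁ (refl , refl) , refl) glued = glued
  GluedAlong-resp-≈ᴬ (inj₂ (refl , refl) , refl) (i , i' , ∂ᵢ≡ , ∂ᵢ'≡ , σᵢ≢σ'ᵢ' , allowed) =
    i' , i , ∂ᵢ'≡ , ∂ᵢ≡ , σᵢ≢σ'ᵢ' ∘ sym , Sum.swap allowed

  GluedAlong-face-unique : {τ τ' : Face} {z : Cand n m} → Distinct (proj₁ z) →
                           GluedAlong τ z → GluedAlong τ' z → τ ≡ τ'
  GluedAlong-face-unique {z = σ , σ' , _} σ-distinct
                         (i , i' , ∂ᵢ≡ , ∂ᵢ'≡ , σᵢ≢σ'ᵢ' , _) (j , j' , ∂ⱼ≡ , ∂ⱼ'≡ , _ , _) =
    trans (sym ∂ᵢ≡) (trans (cong (λ k → ∂ k σ) i≡j) ∂ⱼ≡)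
    where
    i≡j : i ≡ j
    i≡j = common-face-unique σ σ' σ-distinct (trans ∂ᵢ≡ (sym ∂ᵢ'≡)) σᵢ≢σ'ᵢ' (trans ∂ⱼ≡ (sym ∂ⱼ'≡))

  ∈-block⁻ : (xs : List Cell) (τ : Face) {z : Cand n m} → z ∈ block xs τ →
             proj₁ z ∈ xs × proj₁ (proj₂ z) ∈ xs × GluedAlong τ z
  ∈-block⁻ xs τ z∈ with find (∈-concatMap⁻ emit {xs = pairs (coB xs τ)} z∈)
  ... | (p@(σ , i , _) , q@(σ' , i' , _)) , pq∈ , z∈emit
    with pairs-⊆ (coB xs τ) pq∈ | emit-sound p q z∈emit
  ...   | p∈ , q∈ | σᵢ≢σ'ᵢ' , _ , refl , allowed with ∈-coB⁻ xs τ p∈ | ∈-coB⁻ xs τ q∈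
  ...     | σ∈ , ∂ᵢ≡ , refl | σ'∈ , ∂ᵢ'≡ , refl =
    σ∈ , σ'∈ , i , i' , ∂ᵢ≡ , ∂ᵢ'≡ , σᵢ≢σ'ᵢ' , allowed

  -- The entries of σ and σ' in coB(τ) form a pair in one of the two orders; the
  -- orientation test does not depend on that order.
  block-complete : (xs : List Cell) (τ : Face) {σ σ' : Cell} {e : Fin n × Fin n} →
                   σ ∈ xs → σ' ∈ xs → GluedAlong τ (σ , σ' , e) →
                   Any (_≈ᴬ (σ , σ' , e)) (block xs τ)
  block-complete xs τ σ∈ σ'∈ (i , i' , ∂ᵢ≡ , ∂ᵢ'≡ , σᵢ≢σ'ᵢ' , allowed)
    with ∈-pairs (coB xs τ) (∈-coB⁺ xs τ (σ∈ , ∂ᵢ≡ , refl)) (∈-coB⁺ xs τ (σ'∈ , ∂ᵢ'≡ , refl))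
                 (σᵢ≢σ'ᵢ' ∘ cong (proj₂ ∘ proj₂))
  ... | inj₁ pq∈ = lose (∈-concatMap⁺ emit (lose pq∈ (emit-complete σᵢ≢σ'ᵢ' allowed)))
                        (inj₁ (refl , refl) , refl)
  ... | inj₂ qp∈ = lose (∈-concatMap⁺ emit
                          (lose qp∈ (emit-complete (σᵢ≢σ'ᵢ' ∘ sym) (Sum.swap allowed))))
                        (inj₂ (refl , refl) , refl)

  module _ {xs : List Cell} (distinct : ∀ {σ} → σ ∈ xs → Distinct σ) (unique : Unique xs) where

    -- Within the appends of one σ the faces ∂ⱼσ are pairwise different.
    appends-apart : AllPairs (λ a b → proj₁ a ≡ proj₁ b → proj₁ (proj₂ a) ≢ proj₁ (proj₂ b))
                             (appends xs)
    appends-apart = AllPairs-concatMap⁺ _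
      (λ {σ} σ∈ → AllPairs.map⁺ (AllPairs.tabulate⁺
        λ {i} {j} i≢j ∂ᵢ≡∂ⱼ _ → i≢j (removeAt-injective σ (distinct σ∈) i j ∂ᵢ≡∂ⱼ)))
      (AllPairs.map across unique)
      where
      across : ∀ {σ σ'} → σ ≢ σ' → ∀ {a b} →
               a ∈ map (λ j → (∂ j σ , σ , j , lookup σ j)) (allFin (suc (suc m))) →
               b ∈ map (λ j → (∂ j σ' , σ' , j , lookup σ' j)) (allFin (suc (suc m))) →
               proj₁ a ≡ proj₁ b → proj₁ (proj₂ a) ≢ proj₁ (proj₂ b)
      across σ≢σ' a∈ b∈ _ with ∈-map⁻ _ a∈ | ∈-map⁻ _ b∈
      ... | _ , _ , refl | _ , _ , refl = σ≢σ'

    coB-apart : (τ : Face) → AllPairs (λ x y → proj₁ x ≢ proj₁ y) (coB xs τ)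
    coB-apart τ = AllPairs.map⁺ (AllPairs-restrict (All.all-filter (at τ) (appends xs))
      (AllPairs.map (λ r a-at-τ b-at-τ → r (trans a-at-τ (sym b-at-τ)))
                    (AllPairs.filter⁺ (at τ) appends-apart)))

    coB-vertex-multiplicity : (τ : Face) (w : Fin n) →
                              length (filter (λ y → w ≟ proj₂ (proj₂ y)) (coB xs τ)) ≤ suc (suc m)
    coB-vertex-multiplicity τ w = length-≤-of-injective (proj₁ ∘ proj₂)
      (AllPairs-restrict
        (All.tabulate λ y∈ → Product.map₁ (∈-coB⁻ xs τ) (∈-filter⁻ (λ y → w ≟ proj₂ (proj₂ y)) y∈))
        (AllPairs.map same-index⇒same-key (AllPairs.filter⁺ _ (coB-apart τ))))
      where
      same-index⇒same-key : ∀ {a b} → proj₁ a ≢ proj₁ b →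
        InCoB xs τ a × w ≡ proj₂ (proj₂ a) → InCoB xs τ b × w ≡ proj₂ (proj₂ b) →
        proj₁ (proj₂ a) ≢ proj₁ (proj₂ b)
      same-index⇒same-key {σ , j , _} {σ' , .j , _} σ≢σ'
                          ((_ , ∂ⱼσ≡τ , σⱼ≡v) , refl) ((_ , ∂ⱼσ'≡τ , σ'ⱼ≡v') , w≡v') refl =
        σ≢σ' (trans (sym (insertAt-removeAt′ σ j ∂ⱼσ≡τ σⱼ≡v))
                    (insertAt-removeAt′ σ' j ∂ⱼσ'≡τ (trans σ'ⱼ≡v' (sym w≡v'))))

    block-apart : (τ : Face) → AllPairs (λ z w → ¬ z ≈ᴬ w) (block xs τ)
    block-apart τ = AllPairs-concatMap⁺ emit (λ { {p , q} _ → emit-apart p q })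
      (AllPairs.map (λ {u} {w} → across u w) (pairs-apart proj₁ (coB-apart τ)))
      where
      across : ((p , q) (p' , q') : Entry n m × Entry n m) →
               ¬ (proj₁ p , proj₁ q) ≐ (proj₁ p' , proj₁ q') → ∀ {z w} →
               z ∈ emit (p , q) → w ∈ emit (p' , q') → ¬ z ≈ᴬ w
      across (p , q) (p' , q') apart z∈ w∈ with emit-sound p q z∈ | emit-sound p' q' w∈
      ... | _ , _ , refl , _ | _ , _ , refl , _ = apart ∘ proj₁

    ads-enumerator-apart : {ts : List Face} → Unique ts →
                           AllPairs (λ z w → ¬ z ≈ᴬ w) (ads-enumerator m xs ts)
    ads-enumerator-apart unique-ts = AllPairs-concatMap⁺ (block xs) (λ {τ} _ → block-apart τ)
      (AllPairs.map across unique-ts)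
      where
      across : ∀ {τ τ'} → τ ≢ τ' → ∀ {z w} → z ∈ block xs τ → w ∈ block xs τ' → ¬ z ≈ᴬ w
      across {τ} {τ'} τ≢τ' {z} z∈ w∈ z≈w with ∈-block⁻ xs τ z∈ | ∈-block⁻ xs τ' w∈
      ... | σ∈ , _ , z-glued | _ , _ , w-glued =
        τ≢τ' (GluedAlong-face-unique {z = z} (distinct σ∈) z-glued (GluedAlong-resp-≈ᴬ z≈w w-glued))

    sum-length-pairs-coB-≤ : {ts : List Face} → Unique ts →
      sum (map (λ τ → length (pairs (coB xs τ))) ts)
        ≤ length (ads-enumerator m xs ts) + suc (suc m) * (length xs * suc (suc m))
    sum-length-pairs-coB-≤ {ts} unique-ts = begin
        sum (map (λ τ → length (pairs (coB xs τ))) ts)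
      ≤⟨ sum-map-mono-≤ ts (λ τ → length-pairs-≤ (λ x y → proj₂ (proj₂ x) ≟ proj₂ (proj₂ y))
           emit emit-nonempty d (coB xs τ) (coB-vertex-multiplicity τ ∘ proj₂ ∘ proj₂)) ⟩
        sum (map (λ τ → length (block xs τ) + d * length (coB xs τ)) ts)
      ≡⟨ sum-map-+ _ _ ts ⟩
        sum (map (length ∘ block xs) ts) + sum (map (λ τ → d * length (coB xs τ)) ts)
      ≡⟨ cong₂ _+_ (sym (length-concatMap (block xs) ts)) (sum-map-* d _ ts) ⟩
        length (ads-enumerator m xs ts) + d * sum (map (λ τ → length (coB xs τ)) ts)
      ≤⟨ ℕ.+-monoʳ-≤ (length (ads-enumerator m xs ts))
                     (ℕ.*-monoʳ-≤ d (sum-length-coB-≤ xs unique-ts)) ⟩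
        length (ads-enumerator m xs ts) + d * (length xs * d)
      ∎
      where
      open ℕ.≤-Reasoning
      d = suc (suc m)

    ads-cost-≤ : {ts : List Face} → Unique ts →
      ads-cost m xs ts ≤ 2 * (length ts + suc (suc m) * suc (suc m) * length xs + length (ads-enumerator m xs ts))
    ads-cost-≤ {ts} unique-ts = begin
        ads-cost m xs ts
      ≡⟨ cong₂ _+_ (cong₂ _+_ (sum-map-const 1 ts) initialisation)
                   (trans (sum-map-+ _ _ ts) (cong (_+ P) (sum-map-const 1 ts))) ⟩
        length ts * 1 + length xs * (d * d) + (length ts * 1 + P)
      ≤⟨ ℕ.+-monoʳ-≤ (length ts * 1 + length xs * (d * d))
                     (ℕ.+-monoʳ-≤ (length ts * 1) (sum-length-pairs-coB-≤ unique-ts)) ⟩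
        length ts * 1 + length xs * (d * d) + (length ts * 1 + (A + d * (length xs * d)))
      ≤⟨ ℕ.m≤m+n _ A ⟩
        length ts * 1 + length xs * (d * d) + (length ts * 1 + (A + d * (length xs * d))) + A
      ≡⟨ regroup (length ts) (length xs) d A ⟩
        2 * (length ts + d * d * length xs + A)
      ∎
      where
      open ℕ.≤-Reasoning
      d = suc (suc m)
      A = length (ads-enumerator m xs ts)
      P = sum (map (λ τ → length (pairs (coB xs τ))) ts)
      initialisation : sum (map (λ _ → sum (map (λ _ → d) (allFin d))) xs) ≡ length xs * (d * d)
      initialisation = trans (sum-map-const _ xs)
        (cong (length xs *_) (trans (sum-map-const d (allFin d)) (cong (_* d) (List.length-tabulate {n = d} id))))
      regroup : (t s k a : ℕ) → t * 1 + s * (k * k) + (t * 1 + (a + k * (s * k))) + a ≡ 2 * (t + k * k * s + a)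
      regroup = solve-∀

glued⇒IsAlmostSimplex : {n m : ℕ} (E : Fin n → Fin n → Set) {τ : Vec (Fin n) (suc m)} {z : Cand n m} →
                        IsSimplex E (suc m) (proj₁ z) → IsSimplex E (suc m) (proj₁ (proj₂ z)) →
                        GluedAlong τ z → IsAlmostSimplex E m z
glued⇒IsAlmostSimplex E σ-simplex σ'-simplex (i , i' , ∂ᵢ≡ , ∂ᵢ'≡ , σᵢ≢σ'ᵢ' , allowed) =
  σ-simplex , σ'-simplex , i , i' , trans ∂ᵢ≡ (sym ∂ᵢ'≡) , σᵢ≢σ'ᵢ' , allowed

IsAlmostSimplex⇒glued : {n m : ℕ} (E : Fin n → Fin n → Set) {z : Cand n m} → IsAlmostSimplex E m z →
                        ∃ λ i → GluedAlong (∂ i (proj₁ z)) z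
IsAlmostSimplex⇒glued E (_ , _ , i , i' , ∂ᵢ≡∂ᵢ' , σᵢ≢σ'ᵢ' , allowed) =
  i , i , i' , refl , sym ∂ᵢ≡∂ᵢ' , σᵢ≢σ'ᵢ' , allowed

module _ {n : ℕ} (E : Fin n → Fin n → Set) (S : (k : ℕ) → List (Vec (Fin n) (suc k)))
         (flag : IsFlagComplexArrays E S) (m : ℕ) where

  private
    xs = S (suc m)
    ts = S m
    ads = ads-enumerator m xs ts

    simplex : ∀ {σ} → σ ∈ xs → IsSimplex E (suc m) σ
    simplex {σ} = Equivalence.to (proj₂ (flag (suc m)) σ)

    listed : ∀ {k σ} → IsSimplex E k σ → σ ∈ S k
    listed {k} {σ} = Equivalence.from (proj₂ (flag k) σ)

    distinct : ∀ {σ} → σ ∈ xs → Distinct σ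
    distinct = proj₁ ∘ simplex

    apart : AllPairs (λ z w → ¬ z ≈ᴬ w) ads
    apart = ads-enumerator-apart distinct (proj₁ (flag (suc m))) (proj₁ (flag m))

  ads-enumerator-sound : ∀ {z} → z ∈ ads → IsAlmostSimplex E m z
  ads-enumerator-sound {z} z∈ with find (∈-concatMap⁻ (block xs) {xs = ts} z∈)
  ... | τ , _ , z∈block with ∈-block⁻ xs τ z∈block
  ...   | σ∈ , σ'∈ , glued = glued⇒IsAlmostSimplex E {z = z} (simplex σ∈) (simplex σ'∈) glued

  ads-enumerator-complete : (a : Cand n m) → IsAlmostSimplex E m a → Any (_≈ᴬ a) ads
  ads-enumerator-complete a@(σ , σ' , _) almost@(σ-simplex , σ'-simplex , _)
    with IsAlmostSimplex⇒glued E {z = a} almost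
  ... | i , glued = Any.concat⁺ (Any.map⁺ (lose (listed (∂-IsSimplex E m {σ} σ-simplex i))
                      (block-complete xs (∂ i σ) (listed σ-simplex) (listed σ'-simplex) glued)))

  ads-enumerator-enumerates : EnumeratesExactlyOnce E m ads
  ads-enumerator-enumerates =
    (λ k → ads-enumerator-sound (∈-lookup k)) ,
    λ a almost → let found = ads-enumerator-complete a almost in
      (Any.index found , Any.lookup-index found) ,
      λ k k' → AllPairs-lookup-unique ≈ᴬ-sym ≈ᴬ-trans apart k k'

  ads-cost-≤-enumeration : (L : List (Cand n m)) → EnumeratesExactlyOnce E m L →
    ads-cost m xs ts ≤ 2 * (length ts + suc (suc m) * suc (suc m) * length xs + length L)
  ads-cost-≤-enumeration L (_ , L-complete) =
    ℕ.≤-trans (ads-cost-≤ distinct (proj₁ (flag (suc m))) (proj₁ (flag m)))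
              (ℕ.*-monoʳ-≤ 2 (ℕ.+-monoʳ-≤ (length ts + suc (suc m) * suc (suc m) * length xs) ads≤L))
    where
    ads≤L : length ads ≤ length L
    ads≤L = length-≤-of-cover ≈ᴬ-sym ≈ᴬ-trans apart L
      (λ k → proj₁ (L-complete _ (ads-enumerator-sound (∈-lookup k))))

proposition1 : Σ ℕ λ C →
    {n : ℕ} (E : Fin n → Fin n → Set) → IsSimple E →
    (S : (k : ℕ) → List (Vec (Fin n) (suc k))) → IsFlagComplexArrays E S →
    (D : ℕ) → IsMaxDim E D →
    (m : ℕ) → suc m ≤ D →
      EnumeratesExactlyOnce E m (ads-enumerator m (S (suc m)) (S m))
    × ((L : List (Cand n m)) → EnumeratesExactlyOnce E m L →
         ads-cost m (S (suc m)) (S m)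
           ≤ C * (length (S m) + suc (suc m) * suc (suc m) * length (S (suc m)) + length L))
proposition1 = 2 , λ E _ S flag _ _ m _ →
  ads-enumerator-enumerates E S flag m , ads-cost-≤-enumeration E S flag m
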